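{- For every integer $a$, the limiting density of occurrence of $a$ in the infinity series is $0$; that is, $\lim_{M \to \infty} \frac{1}{M} \left| \{ n : 0 \leq n < M,\ s(n) = a \} \right| = 0$.
   Context: The infinity series $(s(n))_{n \geq 0}$ is the integer sequence defined by $s(0)=0$, $s(2n) = -s(n)$ for $n \geq 1$, and $s(2n+1) = s(n)+1$ for $n \geq 0$. -}

module Defs where

open import Data.Nat using (ℕ; zero; suc; ⌊_/2⌋)
open import Data.Integer as ℤ using (ℤ; +_; -_; _+_)
open import Data.List using (List; length; filter; upTo)
open import Data.Bool using (Bool; true; false; not)

isOdd : ℕ → Bool
isOdd zero    = false
isOdd (suc n) = not (isOdd n)

-- Auxiliary: s computed with a fuel parameter (fuel ≥ n suffices).
-- Recurrences: s(0)=0, s(2n) = -s(n) (n≥1), s(2n+1) = s(n)+1.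
sFuel : ℕ → ℕ → ℤ
sFuel zero    _ = + 0
sFuel (suc f) zero = + 0
sFuel (suc f) (suc n) with isOdd (suc n)
... | false = - sFuel f ⌊ suc n /2⌋
... | true  = sFuel f ⌊ suc n /2⌋ + + 1

s : ℕ → ℤ
s n = sFuel n n

count : ℤ → ℕ → ℕ
count a M = length (filter (λ n → s n ℤ.≟ a) (upTo M))

module Submission where

-- Splitting n < 2M by parity, s(2n) = -s(n) and s(2n+1) = s(n) + 1 give
-- count_a(2M) = count_{-a}(M) + count_{a-1}(M). Together with the reflection
-- count_{-a}(2M) = count_{1+a}(2M) this is Pascal's rule, so among the first 2^(k+1) terms
-- the value a occurs exactly C(k, ⌊(a+k)/2⌋) times (never if a + k < 0). Binomial
-- coefficients peak in the middle and C(2m,m)² (2m+1) ≤ 16^m, so for 4^h ≤ M < 4^(h+1)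
-- the value a occurs at most C(2h+2,h+1) = O(M / √h) times among the first M terms.

module Unimodal where

  open import Data.Nat
  open import Data.Nat.Properties
  open import Data.Sum using (inj₁; inj₂)
  open import Relation.Binary.PropositionalEquality using (refl)

  module _ (f : ℕ → ℕ) {h : ℕ} where

    rising⇒mono : (∀ {k} → k < h → f k ≤ f (suc k)) →
                  ∀ {i j} → i ≤ j → j ≤ h → f i ≤ f j
    rising⇒mono up {j = zero}  z≤n _ = ≤-refl
    rising⇒mono up {i} {suc j} i≤1+j 1+j≤h with m≤n⇒m<n∨m≡n i≤1+j
    ... | inj₂ refl = ≤-refl
    ... | inj₁ i<1+j = ≤-trans (rising⇒mono up (s≤s⁻¹ i<1+j) (<⇒≤ 1+j≤h)) (up 1+j≤h)

    falling⇒≤peak : (∀ {k} → h ≤ k → f (suc k) ≤ f k) → ∀ {k} → h ≤ k → f k ≤ f h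
    falling⇒≤peak down {k} h≤k with m≤n⇒m<n∨m≡n h≤k
    ... | inj₂ refl = ≤-refl
    falling⇒≤peak down {suc k} _ | inj₁ (s≤s h≤k) = ≤-trans (down h≤k) (falling⇒≤peak down h≤k)

    unimodal⇒≤peak : (∀ {k} → k < h → f k ≤ f (suc k)) → (∀ {k} → h ≤ k → f (suc k) ≤ f k) →
                     ∀ k → f k ≤ f h
    unimodal⇒≤peak up down k with ≤-total k h
    ... | inj₁ k≤h = rising⇒mono up k≤h ≤-refl
    ... | inj₂ h≤k = falling⇒≤peak down h≤k

module Binomial where

  open import Data.Nat
  open import Data.Nat.Properties
  open import Data.Nat.Combinatorics
  open import Data.Nat.Tactic.RingSolver using (solve-∀)
  open import Relation.Binary.PropositionalEquality
  open Unimodal using (unimodal⇒≤peak)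

  nC0≡1 : ∀ n → n C 0 ≡ 1
  nC0≡1 n = trans (nCk≡nC[n∸k] {0} {n} z≤n) (nCn≡1 n)

  [n+1]C[k+1]*[k+1]≡nCk*[n+1] : ∀ n k → (suc n C suc k) * suc k ≡ (n C k) * suc n
  [n+1]C[k+1]*[k+1]≡nCk*[n+1] n zero = begin
    (suc n C 1) * 1 ≡⟨ *-identityʳ _ ⟩
    suc n C 1       ≡⟨ nC1≡n (suc n) ⟩
    suc n           ≡⟨ *-identityˡ (suc n) ⟨
    1 * suc n       ≡⟨ cong (_* suc n) (nC0≡1 n) ⟨
    (n C 0) * suc n ∎
    where open ≡-Reasoning
  [n+1]C[k+1]*[k+1]≡nCk*[n+1] zero (suc k)
    rewrite k>n⇒nCk≡0 {1} {suc (suc k)} (s<s z<s) | k>n⇒nCk≡0 {0} {suc k} z<s = refl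
  [n+1]C[k+1]*[k+1]≡nCk*[n+1] (suc n) (suc k) = begin
    (suc (suc n) C suc (suc k)) * suc (suc k)
      ≡⟨ cong (_* suc (suc k)) (nCk+nC[k+1]≡[n+1]C[k+1] (suc n) (suc k)) ⟨
    (X + Y) * suc (suc k)
      ≡⟨ *-distribʳ-+ (suc (suc k)) X Y ⟩
    X * suc (suc k) + Y * suc (suc k)
      ≡⟨ cong (_+ Y * suc (suc k)) (*-suc X (suc k)) ⟩
    X + X * suc k + Y * suc (suc k)
      ≡⟨ +-assoc X (X * suc k) (Y * suc (suc k)) ⟩
    X + (X * suc k + Y * suc (suc k))
      ≡⟨ cong (X +_) (cong₂ _+_ ([n+1]C[k+1]*[k+1]≡nCk*[n+1] n k)
                                ([n+1]C[k+1]*[k+1]≡nCk*[n+1] n (suc k))) ⟩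
    X + ((n C k) * suc n + (n C suc k) * suc n)
      ≡⟨ cong (X +_) (*-distribʳ-+ (suc n) (n C k) (n C suc k)) ⟨
    X + (n C k + n C suc k) * suc n
      ≡⟨ cong (λ Z → X + Z * suc n) (nCk+nC[k+1]≡[n+1]C[k+1] n k) ⟩
    X + X * suc n
      ≡⟨ *-suc X (suc n) ⟨
    X * suc (suc n) ∎
    where
    open ≡-Reasoning
    X = suc n C suc k
    Y = suc n C suc (suc k)

  nC[k+1]*[k+1]≡nCk*[n∸k] : ∀ n k → (n C suc k) * suc k ≡ (n C k) * (n ∸ k)
  nC[k+1]*[k+1]≡nCk*[n∸k] n k = begin
    (n C suc k) * suc k
      ≡⟨ m+n∸m≡n ((n C k) * suc k) _ ⟨
    (n C k) * suc k + (n C suc k) * suc k ∸ (n C k) * suc k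
      ≡⟨ cong (_∸ (n C k) * suc k) (*-distribʳ-+ (suc k) (n C k) (n C suc k)) ⟨
    (n C k + n C suc k) * suc k ∸ (n C k) * suc k
      ≡⟨ cong (λ Z → Z * suc k ∸ (n C k) * suc k) (nCk+nC[k+1]≡[n+1]C[k+1] n k) ⟩
    (suc n C suc k) * suc k ∸ (n C k) * suc k
      ≡⟨ cong (_∸ (n C k) * suc k) ([n+1]C[k+1]*[k+1]≡nCk*[n+1] n k) ⟩
    (n C k) * suc n ∸ (n C k) * suc k
      ≡⟨ *-distribˡ-∸ (n C k) (suc n) (suc k) ⟨
    (n C k) * (n ∸ k) ∎
    where open ≡-Reasoning

  nCk≤nC[k+1] : ∀ {n k} → suc k ≤ n ∸ k → n C k ≤ n C suc k
  nCk≤nC[k+1] {n} {k} le = *-cancelʳ-≤ (n C k) (n C suc k) (suc k) (begin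
    (n C k) * suc k   ≤⟨ *-monoʳ-≤ (n C k) le ⟩
    (n C k) * (n ∸ k) ≡⟨ nC[k+1]*[k+1]≡nCk*[n∸k] n k ⟨
    (n C suc k) * suc k ∎)
    where open ≤-Reasoning

  nC[k+1]≤nCk : ∀ {n k} → n ∸ k ≤ suc k → n C suc k ≤ n C k
  nC[k+1]≤nCk {n} {k} le = *-cancelʳ-≤ (n C suc k) (n C k) (suc k) (begin
    (n C suc k) * suc k ≡⟨ nC[k+1]*[k+1]≡nCk*[n∸k] n k ⟩
    (n C k) * (n ∸ k) ≤⟨ *-monoʳ-≤ (n C k) le ⟩
    (n C k) * suc k   ∎)
    where open ≤-Reasoning

  [2m]Ck≤[2m]Cm : ∀ m k → (m + m) C k ≤ (m + m) C m
  [2m]Ck≤[2m]Cm m = unimodal⇒≤peak ((m + m) C_) rising falling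
    where
    rising : ∀ {k} → k < m → (m + m) C k ≤ (m + m) C suc k
    rising {k} k<m = nCk≤nC[k+1] (m+n≤o⇒m≤o∸n (suc k) (+-mono-≤ k<m (<⇒≤ k<m)))
    falling : ∀ {k} → m ≤ k → (m + m) C suc k ≤ (m + m) C k
    falling {k} m≤k = nC[k+1]≤nCk (m≤n+o⇒m∸n≤o (m + m) k (+-mono-≤ m≤k (m≤n⇒m≤1+n m≤k)))

  [2m+2]C[m+1]*[m+1]≡2*[2m]Cm*[2m+1] :
    ∀ m → ((suc m + suc m) C suc m) * suc m ≡ 2 * (((m + m) C m) * suc (m + m))
  [2m+2]C[m+1]*[m+1]≡2*[2m]Cm*[2m+1] m = begin
    ((suc m + suc m) C suc m) * suc m
      ≡⟨ cong (λ n → (n C suc m) * suc m) (cong suc (+-suc m m)) ⟩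
    (suc (suc (m + m)) C suc m) * suc m
      ≡⟨ cong (_* suc m) (nCk+nC[k+1]≡[n+1]C[k+1] (suc (m + m)) m) ⟨
    (suc (m + m) C m + X) * suc m
      ≡⟨ cong (λ Z → (Z + X) * suc m) symmetric ⟩
    (X + X) * suc m
      ≡⟨ cong (_* suc m) (cong (X +_) (sym (+-identityʳ X))) ⟩
    2 * X * suc m
      ≡⟨ *-assoc 2 X (suc m) ⟩
    2 * (X * suc m)
      ≡⟨ cong (2 *_) ([n+1]C[k+1]*[k+1]≡nCk*[n+1] (m + m) m) ⟩
    2 * (((m + m) C m) * suc (m + m)) ∎
    where
    open ≡-Reasoning
    X = suc (m + m) C suc m
    symmetric : suc (m + m) C m ≡ X
    symmetric = trans (nCk≡nC[n∸k] (m≤n⇒m≤1+n (m≤n+m m m)))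
                      (cong (suc (m + m) C_) (m+n∸n≡m (suc m) m))

  [2m]Cm²*[2m+1]≤4^m² : ∀ m → ((m + m) C m) * ((m + m) C m) * suc (m + m) ≤ 4 ^ m * 4 ^ m
  [2m]Cm²*[2m+1]≤4^m² zero = ≤-refl
  [2m]Cm²*[2m+1]≤4^m² (suc m) = *-cancelʳ-≤ (c′ * c′ * suc (s + s)) (4 ^ s * 4 ^ s) (s * s) (begin
    c′ * c′ * suc (s + s) * (s * s)
      ≡⟨ square-out c′ m ⟩
    (c′ * s) * (c′ * s) * suc (s + s)
      ≡⟨ cong (λ x → x * x * suc (s + s)) ([2m+2]C[m+1]*[m+1]≡2*[2m]Cm*[2m+1] m) ⟩
    (2 * (c * r)) * (2 * (c * r)) * suc (s + s)
      ≡⟨ regroup c m ⟩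
    4 * (r * suc (s + s)) * (c * c * r)
      ≤⟨ *-monoʳ-≤ (4 * (r * suc (s + s))) ([2m]Cm²*[2m+1]≤4^m² m) ⟩
    4 * (r * suc (s + s)) * (4 ^ m * 4 ^ m)
      ≤⟨ *-monoˡ-≤ (4 ^ m * 4 ^ m) (*-monoʳ-≤ 4 (≤-trans (n≤1+n _) (≤-reflexive (odd-product m)))) ⟩
    4 * (4 * (s * s)) * (4 ^ m * 4 ^ m)
      ≡⟨ regroup′ (4 ^ m) s ⟩
    4 ^ s * 4 ^ s * (s * s) ∎)
    where
    open ≤-Reasoning
    s = suc m
    r = suc (m + m)
    c = (m + m) C m
    c′ = (s + s) C s
    square-out : ∀ x m → x * x * suc (suc m + suc m) * (suc m * suc m)
                       ≡ (x * suc m) * (x * suc m) * suc (suc m + suc m)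
    square-out = solve-∀
    regroup : ∀ x m → (2 * (x * suc (m + m))) * (2 * (x * suc (m + m))) * suc (suc m + suc m)
                    ≡ 4 * (suc (m + m) * suc (suc m + suc m)) * (x * x * suc (m + m))
    regroup = solve-∀
    odd-product : ∀ m → suc (suc (m + m) * suc (suc m + suc m)) ≡ 4 * (suc m * suc m)
    odd-product = solve-∀
    regroup′ : ∀ x y → 4 * (4 * (y * y)) * (x * x) ≡ (4 * x) * (4 * x) * (y * y)
    regroup′ = solve-∀

module InfinitySeries where

  open import Defs
  open import Data.Nat
  open import Data.Nat.Properties
  open import Data.Nat.Combinatorics
  open import Data.Integer as ℤ using (ℤ; +_; -[1+_]; -_)
  open import Data.Integer.Properties using (neg-involutive)
  open import Data.Integer.Tactic.RingSolver using (solve-∀)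
  open import Data.List using ([]; _∷_; _++_; length; filter; upTo)
  open import Data.List.Properties using (upTo-∷ʳ; filter-++; length-++)
  open import Data.Bool using (true; false; if_then_else_)
  open import Relation.Nullary using (does; yes; no; contradiction)
  open import Function using (_∘_)
  open import Algebra.Properties.CommutativeSemigroup +-commutativeSemigroup using (interchange)
  open import Relation.Binary.PropositionalEquality
  open Unimodal using (rising⇒mono)
  open Binomial using (nC0≡1; [2m]Ck≤[2m]Cm)

  sFuel-stable : ∀ {n f g} → n ≤ f → n ≤ g → sFuel f n ≡ sFuel g n
  sFuel-stable {zero} {zero}  {zero}  _ _ = refl
  sFuel-stable {zero} {zero}  {suc g} _ _ = refl
  sFuel-stable {zero} {suc f} {zero}  _ _ = refl
  sFuel-stable {zero} {suc f} {suc g} _ _ = refl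
  sFuel-stable {suc n} {suc f} {suc g} (s≤s n≤f) (s≤s n≤g)
    with isOdd (suc n) | sFuel-stable {f = f} {g} (≤-trans half≤n n≤f) (≤-trans half≤n n≤g)
    where half≤n = s≤s⁻¹ (⌊n/2⌋<n n)
  ... | false | halves = cong -_ halves
  ... | true  | halves = cong (ℤ._+ + 1) halves

  isOdd[m+m]≡false : ∀ m → isOdd (m + m) ≡ false
  isOdd[m+m]≡false zero = refl
  isOdd[m+m]≡false (suc m) rewrite +-suc m m | isOdd[m+m]≡false m = refl

  s-even : ∀ m → s (m + m) ≡ - s m
  s-even zero = refl
  s-even (suc m) rewrite +-suc m m | isOdd[m+m]≡false m =
    cong -_ (trans (cong (sFuel (suc (m + m))) (cong suc (sym (n≡⌊n+n/2⌋ m))))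
                   (sFuel-stable (s≤s (m≤n+m m m)) ≤-refl))

  s-odd : ∀ m → s (suc (m + m)) ≡ s m ℤ.+ + 1
  s-odd m rewrite isOdd[m+m]≡false m =
    cong (ℤ._+ + 1) (trans (cong (sFuel (m + m)) (sym (n≡⌈n+n/2⌉ m)))
                           (sFuel-stable (m≤n+m m m) ≤-refl))

  δ : ℤ → ℤ → ℕ
  δ x a = if does (x ℤ.≟ a) then 1 else 0

  δ-inverse : ∀ {f g : ℤ → ℤ} → (∀ x → g (f x) ≡ x) → (∀ y → f (g y) ≡ y) →
              ∀ x a → δ (f x) a ≡ δ x (g a)
  δ-inverse {f} {g} gf fg x a with f x ℤ.≟ a | x ℤ.≟ g a
  ... | yes _   | yes _   = refl
  ... | no  _   | no  _   = refl
  ... | yes fx≡a | no x≢ga = contradiction (trans (sym (gf x)) (cong g fx≡a)) x≢ga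
  ... | no fx≢a  | yes x≡ga = contradiction (trans (cong f x≡ga) (fg a)) fx≢a

  count-suc : ∀ a M → count a (suc M) ≡ count a M + δ (s M) a
  count-suc a M = begin
    length (filter P? (upTo (suc M)))                ≡⟨ cong (length ∘ filter P?) (upTo-∷ʳ M) ⟨
    length (filter P? (upTo M ++ M ∷ []))            ≡⟨ cong length (filter-++ P? (upTo M) (M ∷ [])) ⟩
    length (filter P? (upTo M) ++ filter P? (M ∷ [])) ≡⟨ length-++ (filter P? (upTo M)) ⟩
    count a M + length (filter P? (M ∷ []))          ≡⟨ cong (_+_ (count a M)) last ⟩
    count a M + δ (s M) a                            ∎
    where
    open ≡-Reasoning
    P? = λ n → s n ℤ.≟ a
    last : length (filter P? (M ∷ [])) ≡ δ (s M) a
    last with does (s M ℤ.≟ a)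
    ... | true  = refl
    ... | false = refl

  δ-even : ∀ m a → δ (s (m + m)) a ≡ δ (s m) (- a)
  δ-even m a = trans (cong (λ x → δ x a) (s-even m))
                     (δ-inverse {f = -_} {g = -_} neg-involutive neg-involutive (s m) a)

  δ-odd : ∀ m a → δ (s (suc (m + m))) a ≡ δ (s m) (a ℤ.- + 1)
  δ-odd m a = trans (cong (λ x → δ x a) (s-odd m))
                    (δ-inverse {f = ℤ._+ + 1} {g = ℤ._- + 1} dec-inc inc-dec (s m) a)
    where
    dec-inc : ∀ x → x ℤ.+ + 1 ℤ.- + 1 ≡ x
    dec-inc = solve-∀
    inc-dec : ∀ x → x ℤ.- + 1 ℤ.+ + 1 ≡ x
    inc-dec = solve-∀

  count-double : ∀ a M → count a (M + M) ≡ count (- a) M + count (a ℤ.- + 1) M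
  count-double a zero = refl
  count-double a (suc M) = begin
    count a (suc M + suc M)
      ≡⟨ cong (count a ∘ suc) (+-suc M M) ⟩
    count a (suc (suc (M + M)))
      ≡⟨ count-suc a (suc (M + M)) ⟩
    count a (suc (M + M)) + δ (s (suc (M + M))) a
      ≡⟨ cong₂ _+_ (count-suc a (M + M)) (δ-odd M a) ⟩
    count a (M + M) + δ (s (M + M)) a + δ (s M) (a ℤ.- + 1)
      ≡⟨ cong₂ (λ n d → n + d + δ (s M) (a ℤ.- + 1)) (count-double a M) (δ-even M a) ⟩
    (count (- a) M + count (a ℤ.- + 1) M) + δ (s M) (- a) + δ (s M) (a ℤ.- + 1)
      ≡⟨ +-assoc (count (- a) M + count (a ℤ.- + 1) M) _ _ ⟩
    (count (- a) M + count (a ℤ.- + 1) M) + (δ (s M) (- a) + δ (s M) (a ℤ.- + 1))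
      ≡⟨ interchange (count (- a) M) _ _ _ ⟩
    (count (- a) M + δ (s M) (- a)) + (count (a ℤ.- + 1) M + δ (s M) (a ℤ.- + 1))
      ≡⟨ cong₂ _+_ (count-suc (- a) M) (count-suc (a ℤ.- + 1) M) ⟨
    count (- a) (suc M) + count (a ℤ.- + 1) (suc M) ∎
    where open ≡-Reasoning

  count-reflect : ∀ a M → count (- a) (M + M) ≡ count (+ 1 ℤ.+ a) (M + M)
  count-reflect a M = begin
    count (- a) (M + M)
      ≡⟨ count-double (- a) M ⟩
    count (- - a) M + count (- a ℤ.- + 1) M
      ≡⟨ cong₂ (λ b c → count b M + count c M) (neg-involutive a) (shift a) ⟩
    count a M + count (- (+ 1 ℤ.+ a)) M
      ≡⟨ +-comm (count a M) _ ⟩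
    count (- (+ 1 ℤ.+ a)) M + count a M
      ≡⟨ cong (λ b → count (- (+ 1 ℤ.+ a)) M + count b M) (unshift a) ⟨
    count (- (+ 1 ℤ.+ a)) M + count (+ 1 ℤ.+ a ℤ.- + 1) M
      ≡⟨ count-double (+ 1 ℤ.+ a) M ⟨
    count (+ 1 ℤ.+ a) (M + M) ∎
    where
    open ≡-Reasoning
    shift : ∀ a → - a ℤ.- + 1 ≡ - (+ 1 ℤ.+ a)
    shift = solve-∀
    unshift : ∀ a → + 1 ℤ.+ a ℤ.- + 1 ≡ a
    unshift = solve-∀

  count-mono : ∀ a {M N} → M ≤ N → count a M ≤ count a N
  count-mono a M≤N = rising⇒mono (count a) (λ {k} _ → count≤count[1+] k) M≤N ≤-refl
    where
    count≤count[1+] : ∀ k → count a k ≤ count a (suc k)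
    count≤count[1+] k = ≤-trans (m≤m+n (count a k) (δ (s k) a)) (≤-reflexive (sym (count-suc a k)))

  halfBinomial : ℕ → ℤ → ℕ
  halfBinomial n (+ t)    = n C ⌊ t /2⌋
  halfBinomial n -[1+ _ ] = 0

  halfBinomial-suc : ∀ n u → halfBinomial (suc n) (u ℤ.+ + 1)
                           ≡ halfBinomial n (u ℤ.+ + 1) + halfBinomial n (u ℤ.- + 1)
  halfBinomial-suc n (+ zero)       = trans (nC0≡1 (suc n)) (sym (trans (+-identityʳ (n C 0)) (nC0≡1 n)))
  halfBinomial-suc n (+ suc t) rewrite +-comm t 1 =
    trans (sym (nCk+nC[k+1]≡[n+1]C[k+1] n ⌊ t /2⌋)) (+-comm (n C ⌊ t /2⌋) _)
  halfBinomial-suc n -[1+ zero ]    = trans (nC0≡1 (suc n)) (sym (trans (+-identityʳ (n C 0)) (nC0≡1 n)))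
  halfBinomial-suc n -[1+ suc _ ]   = refl

  2^[1+n]≡2^n+2^n : ∀ n → 2 ^ suc n ≡ 2 ^ n + 2 ^ n
  2^[1+n]≡2^n+2^n n = cong (_+_ (2 ^ n)) (+-identityʳ (2 ^ n))

  count[2^[1+n]]≡halfBinomial : ∀ n a → count a (2 ^ suc n) ≡ halfBinomial n (a ℤ.+ + n)
  count[2^[1+n]]≡halfBinomial zero (+ zero)          = refl
  count[2^[1+n]]≡halfBinomial zero (+ suc zero)      = refl
  count[2^[1+n]]≡halfBinomial zero (+ suc (suc t))   = sym (k>n⇒nCk≡0 {0} {suc ⌊ t + 0 /2⌋} z<s)
  count[2^[1+n]]≡halfBinomial zero -[1+ _ ]          = refl
  count[2^[1+n]]≡halfBinomial (suc n) a = begin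
    count a (2 ^ suc (suc n))
      ≡⟨ cong (count a) (2^[1+n]≡2^n+2^n (suc n)) ⟩
    count a (N + N)
      ≡⟨ count-double a N ⟩
    count (- a) N + count (a ℤ.- + 1) N
      ≡⟨ cong (_+ count (a ℤ.- + 1) N) (reflect-at-N a) ⟩
    count (+ 1 ℤ.+ a) N + count (a ℤ.- + 1) N
      ≡⟨ cong₂ _+_ (count[2^[1+n]]≡halfBinomial n (+ 1 ℤ.+ a))
                   (count[2^[1+n]]≡halfBinomial n (a ℤ.- + 1)) ⟩
    halfBinomial n (+ 1 ℤ.+ a ℤ.+ + n) + halfBinomial n (a ℤ.- + 1 ℤ.+ + n)
      ≡⟨ cong₂ (λ u v → halfBinomial n u + halfBinomial n v) (up a (+ n)) (down a (+ n)) ⟩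
    halfBinomial n (a ℤ.+ + n ℤ.+ + 1) + halfBinomial n (a ℤ.+ + n ℤ.- + 1)
      ≡⟨ halfBinomial-suc n (a ℤ.+ + n) ⟨
    halfBinomial (suc n) (a ℤ.+ + n ℤ.+ + 1)
      ≡⟨ cong (halfBinomial (suc n)) (up′ a (+ n)) ⟩
    halfBinomial (suc n) (a ℤ.+ + suc n) ∎
    where
    open ≡-Reasoning
    N = 2 ^ suc n
    reflect-at-N : ∀ a → count (- a) N ≡ count (+ 1 ℤ.+ a) N
    reflect-at-N a rewrite 2^[1+n]≡2^n+2^n n = count-reflect a (2 ^ n)
    up : ∀ a m → + 1 ℤ.+ a ℤ.+ m ≡ a ℤ.+ m ℤ.+ + 1
    up = solve-∀
    down : ∀ a m → a ℤ.- + 1 ℤ.+ m ≡ a ℤ.+ m ℤ.- + 1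
    down = solve-∀
    up′ : ∀ a m → a ℤ.+ m ℤ.+ + 1 ≡ a ℤ.+ (+ 1 ℤ.+ m)
    up′ = solve-∀

  halfBinomial[2m]≤[2m]Cm : ∀ m u → halfBinomial (m + m) u ≤ (m + m) C m
  halfBinomial[2m]≤[2m]Cm m (+ t)    = [2m]Ck≤[2m]Cm m ⌊ t /2⌋
  halfBinomial[2m]≤[2m]Cm m -[1+ _ ] = z≤n

  4^m≤2^[1+m+m] : ∀ m → 4 ^ m ≤ 2 ^ suc (m + m)
  4^m≤2^[1+m+m] m = begin
    4 ^ m            ≡⟨ ^-*-assoc 2 2 m ⟩
    2 ^ (2 * m)      ≡⟨ cong (λ k → 2 ^ (m + k)) (+-identityʳ m) ⟩
    2 ^ (m + m)      ≤⟨ ^-monoʳ-≤ 2 (n≤1+n (m + m)) ⟩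
    2 ^ suc (m + m)  ∎
    where open ≤-Reasoning

  count≤[2m]Cm : ∀ a m {M} → M ≤ 4 ^ m → count a M ≤ (m + m) C m
  count≤[2m]Cm a m {M} M≤4^m = begin
    count a M                              ≤⟨ count-mono a (≤-trans M≤4^m (4^m≤2^[1+m+m] m)) ⟩
    count a (2 ^ suc (m + m))              ≡⟨ count[2^[1+n]]≡halfBinomial (m + m) a ⟩
    halfBinomial (m + m) (a ℤ.+ + (m + m)) ≤⟨ halfBinomial[2m]≤[2m]Cm m (a ℤ.+ + (m + m)) ⟩
    (m + m) C m                            ∎
    where open ≤-Reasoning

module Density where

  open import Defs
  open import Data.Nat
  open import Data.Nat.Properties
  open import Data.Nat.Tactic.RingSolver using (solve-∀)
  open import Data.Product using (∃; _×_; _,_)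
  open import Data.Sum using (inj₁; inj₂)
  open import Relation.Nullary using (contradiction)
  open import Relation.Binary.PropositionalEquality
  open Binomial using ([2m]Cm²*[2m+1]≤4^m²)
  open InfinitySeries using (count≤[2m]Cm)

  power-bracket : ∀ b → 1 < b → ∀ M → ∃ λ h → b ^ h ≤ suc M × suc M < b ^ suc h
  power-bracket b 1<b zero = 0 , ≤-refl , ^-monoʳ-< b 1<b {0} {1} z<s
  power-bracket b 1<b (suc M) with power-bracket b 1<b M
  ... | h , lo , hi with m≤n⇒m<n∨m≡n hi
  ...   | inj₁ lt = h , m≤n⇒m≤1+n lo , lt
  ...   | inj₂ eq = suc h , ≤-reflexive (sym eq) ,
                    subst (_< b ^ suc (suc h)) (sym eq) (^-monoʳ-< b 1<b (n<1+n (suc h)))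

  ratio-bound : ∀ {c X t Y r M q} .{{_ : NonZero M}} →
                c ≤ X → X * X * t ≤ Y * Y → Y ≤ r * M → r * r * (q * q) < t → c * q < M
  ratio-bound {c} {X} {t} {Y} {r} {M} {q} c≤X X²t≤Y² Y≤rM small =
    ≰⇒> (λ M≤cq → <⇒≱ small (large M≤cq))
    where
    open ≤-Reasoning
    regroup : ∀ t X q → t * ((X * q) * (X * q)) ≡ X * X * t * (q * q)
    regroup = solve-∀
    regroup′ : ∀ r M q → (r * M) * (r * M) * (q * q) ≡ r * r * (q * q) * (M * M)
    regroup′ = solve-∀
    large : M ≤ c * q → t ≤ r * r * (q * q)
    large M≤cq = *-cancelʳ-≤ t (r * r * (q * q)) (M * M) {{m*n≢0 M M}} (begin
      t * (M * M)                 ≤⟨ *-monoʳ-≤ t (*-mono-≤ M≤Xq M≤Xq) ⟩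
      t * ((X * q) * (X * q))     ≡⟨ regroup t X q ⟩
      X * X * t * (q * q)         ≤⟨ *-monoˡ-≤ (q * q) X²t≤Y² ⟩
      Y * Y * (q * q)             ≤⟨ *-monoˡ-≤ (q * q) (*-mono-≤ Y≤rM Y≤rM) ⟩
      (r * M) * (r * M) * (q * q) ≡⟨ regroup′ r M q ⟩
      r * r * (q * q) * (M * M)   ∎)
      where M≤Xq = ≤-trans M≤cq (*-monoˡ-≤ q c≤X)

  -- For 4^h ≤ M < 4^(h+1) the count is at most C(2h+2,h+1), whose square is at most
  -- (4M)² / (2h+3); M ≥ threshold q forces h ≥ 8q², which brings this below (M/q)².
  threshold : ℕ → ℕ
  threshold q = 4 ^ (8 * (q * q))

  count*q<M : ∀ a q M → threshold q ≤ M → count a M * q < M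
  count*q<M a q zero 4^K≤0 = contradiction 4^K≤0 (<⇒≱ (m^n>0 4 (8 * (q * q))))
  count*q<M a q (suc M) 4^K≤M with power-bracket 4 (s<s z<s) M
  ... | h , lo , hi = ratio-bound {r = 4} (count≤[2m]Cm a (suc h) (<⇒≤ hi))
                                          ([2m]Cm²*[2m+1]≤4^m² (suc h)) (*-monoʳ-≤ 4 lo) small
    where
    K = 8 * (q * q)
    K≤h : K ≤ h
    K≤h = ≮⇒≥ (λ h<K → <⇒≱ hi (≤-trans (^-monoʳ-≤ 4 h<K) 4^K≤M))
    16q²≡K+K : ∀ q → 4 * 4 * (q * q) ≡ 8 * (q * q) + 8 * (q * q)
    16q²≡K+K = solve-∀
    small : 4 * 4 * (q * q) < suc (suc h + suc h)
    small = s≤s (begin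
      4 * 4 * (q * q)  ≡⟨ 16q²≡K+K q ⟩
      K + K            ≤⟨ +-mono-≤ K≤h K≤h ⟩
      h + h            ≤⟨ +-mono-≤ (n≤1+n h) (n≤1+n h) ⟩
      suc h + suc h    ∎)
      where open ≤-Reasoning

open import Defs
open import Data.Nat using (ℕ; NonZero; _≤_)
open import Data.Integer using (ℤ; +_)
open import Data.Rational using (ℚ; 0ℚ; _<_; _/_; _-_; ∣_∣)
open import Data.Product using (∃; _,_)

open import Data.Nat as ℕ using (suc)
open import Data.Nat.Properties using (≤-trans; m≤n*m)
open import Data.Nat.Coprimality using (Coprime)
open import Data.Integer as ℤ using (+<+; -[1+_])
open import Data.Integer.Properties using (pos-*)
open import Data.Integer.GCD using (gcd)
open import Data.Integer.Tactic.RingSolver using (solve-∀)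
open import Data.Rational as ℚ using (mkℚ; ↥_; ↧_; toℚᵘ)
open import Data.Rational.Properties
  using (↥-/; ↧-/; ↥ᵘ-toℚᵘ; ↧ᵘ-toℚᵘ; toℚᵘ-cancel-<; +-identityʳ; 0≤p⇒∣p∣≡p; nonNegative⁻¹; normalize-nonNeg)
open import Data.Rational.Unnormalised as ℚᵘ using (mkℚᵘ; *≡*)
open import Data.Rational.Unnormalised.Properties using (<-respˡ-≃; ≃-sym)
open import Relation.Binary.PropositionalEquality
open Density using (threshold; count*q<M)

toℚᵘ-/ : ∀ i n → toℚᵘ (i / suc n) ℚᵘ.≃ mkℚᵘ i n
toℚᵘ-/ i n = *≡* (begin
  ℚᵘ.↥ toℚᵘ x ℤ.* + suc n           ≡⟨ cong (ℤ._* + suc n) (↥ᵘ-toℚᵘ x) ⟩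
  ↥ x ℤ.* + suc n                   ≡⟨ cong (↥ x ℤ.*_) (↧-/ i (suc n)) ⟨
  ↥ x ℤ.* (↧ x ℤ.* gcd i (+ suc n)) ≡⟨ reassoc (↥ x) (↧ x) _ ⟩
  (↥ x ℤ.* gcd i (+ suc n)) ℤ.* ↧ x ≡⟨ cong (ℤ._* ↧ x) (↥-/ i (suc n)) ⟩
  i ℤ.* ↧ x                         ≡⟨ cong (i ℤ.*_) (↧ᵘ-toℚᵘ x) ⟨
  i ℤ.* ℚᵘ.↧ toℚᵘ x                 ∎)
  where
  open ≡-Reasoning
  x = i / suc n
  reassoc : ∀ a b g → a ℤ.* (b ℤ.* g) ≡ (a ℤ.* g) ℤ.* b
  reassoc = solve-∀

+c/[1+M]<mkℚ : ∀ {c n d M} .{cop : Coprime n (suc d)} →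
               c ℕ.* suc d ℕ.< n ℕ.* suc M → + c / suc M < mkℚ (+ n) d cop
+c/[1+M]<mkℚ {c} {n} {d} {M} lt = toℚᵘ-cancel-< (<-respˡ-≃ (≃-sym (toℚᵘ-/ (+ c) M))
  (ℚᵘ.*<* (subst₂ ℤ._<_ (pos-* c (suc d)) (pos-* n (suc M)) (+<+ lt))))

∣p-0ℚ∣≡p : ∀ {p} → 0ℚ ℚ.≤ p → ∣ p - 0ℚ ∣ ≡ p
∣p-0ℚ∣≡p {p} 0≤p = trans (cong ∣_∣ (+-identityʳ p)) (0≤p⇒∣p∣≡p 0≤p)

corollary4 : (a : ℤ) (ε : ℚ) → 0ℚ < ε →
    ∃ λ (N : ℕ) → (M : ℕ) → .{{_ : NonZero M}} → N ≤ M →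
      ∣ ((+ count a M) / M) - 0ℚ ∣ < ε
corollary4 a ε@(mkℚ (+ suc p) d _) _ = threshold q , density
  where
  q = suc d
  density : (M : ℕ) → .{{_ : NonZero M}} → threshold q ≤ M → ∣ ((+ count a M) / M) - 0ℚ ∣ < ε
  density (suc M) N≤M =
    subst (_< ε) (sym (∣p-0ℚ∣≡p 0≤ratio)) (+c/[1+M]<mkℚ {c = c} (≤-trans c*q<M (m≤n*m (suc M) (suc p))))
    where
    c = count a (suc M)
    c*q<M = count*q<M a q (suc M) N≤M
    0≤ratio = nonNegative⁻¹ (+ c / suc M) {{normalize-nonNeg c (suc M)}}
corollary4 a (mkℚ (+ 0) _ _)    (ℚ.*<* (+<+ ()))
corollary4 a (mkℚ -[1+ _ ] _ _) (ℚ.*<* ())
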